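{- For a given stable matching instance with one-sided uncertainty, there is a $1$-competitive algorithm for finding a stable matching in the comparison query model. Moreover, the stable matching found by this algorithm is the $A$-optimal stable matching.
   Context: Two disjoint sets $A$, $B$ of agents with $|A|=|B|=n$. Each $a\in A$ has a strict total order $\prec_a$ on $B$ and each $b\in B$ has a strict total order $\prec_b$ on $A$; $x\prec_y z$ means that $y$ prefers $x$ to $z$. A matching is a bijection between $A$ and $B$. A pair $(a,b)$ with $b\neq M(a)$ is blocking if $a$ prefers $b$ to $M(a)$ and $b$ prefers $a$ to $M(b)$; $M$ is stable if it has no blocking pair. A stable matching is $A$-optimal if every agent of $A$ weakly prefers its partner in it to its partner in any other stable matching. One-sided uncertainty: the orders $\prec_a$ ($a\in A$) are known initially, the orders $\prec_b$ ($b\in B$) are unknown and are learned only via queries. A comparison query $\mathit{prefer}(b,a_1,a_2)$ returns whichever of $a_1,a_2$ agent $b$ prefers. An algorithm adaptively makes queries until the known information proves its output correct (correct for every $B$-side preference profile consistent with the $A$-side preferences and the answers). It is $\rho$-competitive if on every instance its number of queries is at most $\rho$ times the minimum size of a query set whose answers on that instance suffice to prove some correct output (possibly a different stable matching). -}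

module Defs where

open import Data.Nat using (ℕ; _≤_; _*_)
open import Data.Fin using (Fin; toℕ; _<_; _≤?_)
open import Data.Bool using (Bool; true; false; if_then_else_)
open import Data.List using (List; []; _∷_; length)
open import Data.List.Relation.Unary.All using (All)
open import Data.Product using (_×_; _,_; Σ)
open import Relation.Binary.PropositionalEquality using (_≡_; _≢_)
open import Relation.Nullary using (¬_; does)
open import Function.Definitions using (Injective)

-- Agents: A = Fin n, B = Fin n (two disjoint copies, distinguished by role).

-- A strict total order on a set of n agents, represented by an injective
-- rank function (rank 0 = most preferred).  x ≺ z  iff  rank x < rank z.
record Pref (n : ℕ) : Set where
  field
    rank : Fin n → Fin n
    rank-inj : Injective _≡_ _≡_ rank

open Pref public

Prefers : {n : ℕ} → Pref n → Fin n → Fin n → Set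
Prefers p x z = rank p x < rank p z

-- Preference profiles: each a ∈ A has an order on B, each b ∈ B an order on A.
ProfileA : ℕ → Set
ProfileA n = Fin n → Pref n

ProfileB : ℕ → Set
ProfileB n = Fin n → Pref n

record Matching (n : ℕ) : Set where
  field
    toB : Fin n → Fin n
    toA : Fin n → Fin n
    toA-toB : ∀ a → toA (toB a) ≡ a
    toB-toA : ∀ b → toB (toA b) ≡ b

open Matching public

Blocking : {n : ℕ} → ProfileA n → ProfileB n → Matching n → Fin n → Fin n → Set
Blocking PA PB M a b =
  (b ≢ toB M a) × Prefers (PA a) b (toB M a) × Prefers (PB b) a (toA M b)

Stable : {n : ℕ} → ProfileA n → ProfileB n → Matching n → Set
Stable PA PB M = ∀ a b → ¬ Blocking PA PB M a b

AOptimal : {n : ℕ} → ProfileA n → ProfileB n → Matching n → Set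
AOptimal PA PB M =
  Stable PA PB M ×
  (∀ M' → Stable PA PB M' → ∀ a → toℕ (rank (PA a) (toB M a)) ≤ toℕ (rank (PA a) (toB M' a)))

record Query (n : ℕ) : Set where
  constructor prefer
  field
    qb  : Fin n
    qa₁ : Fin n
    qa₂ : Fin n

answer : {n : ℕ} → ProfileB n → Query n → Fin n
answer PB (prefer b a₁ a₂) =
  if does (rank (PB b) a₁ ≤? rank (PB b) a₂) then a₁ else a₂

Agree : {n : ℕ} → ProfileB n → ProfileB n → List (Query n) → Set
Agree PB PB' Q = All (λ q → answer PB' q ≡ answer PB q) Q

Proves : {n : ℕ} → ProfileA n → ProfileB n → List (Query n) → Matching n → Set
Proves PA PB Q M = ∀ PB' → Agree PB PB' Q → Stable PA PB' M

-- An adaptive algorithm (for a fixed instance with known A-side preferences):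
-- a finite decision tree of comparison queries whose leaves are outputs.
data Alg (n : ℕ) : Set where
  output : Matching n → Alg n
  ask    : Query n → (Fin n → Alg n) → Alg n

run : {n : ℕ} → Alg n → ProfileB n → List (Query n) × Matching n
run (output M) PB = [] , M
run (ask q k) PB with run (k (answer PB q)) PB
... | qs , M = q ∷ qs , M

queries : {n : ℕ} → Alg n → ProfileB n → List (Query n)
queries alg PB = Data.Product.proj₁ (run alg PB)

result : {n : ℕ} → Alg n → ProfileB n → Matching n
result alg PB = Data.Product.proj₂ (run alg PB)

Correct : {n : ℕ} → ProfileA n → Alg n → Set
Correct PA alg = ∀ PB → Proves PA PB (queries alg PB) (result alg PB)

-- ρ-competitive (and correct): on every instance the number of queries is at
-- most ρ times the size of any query set whose answers prove some matching
-- correct (hence at most ρ times the minimum such size).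
Competitive : {n : ℕ} → ℕ → ProfileA n → Alg n → Set
Competitive ρ PA alg =
  Correct PA alg ×
  (∀ PB (Q : List (Query _)) (M' : Matching _) → Proves PA PB Q M' →
     length (queries alg PB) ≤ ρ * length Q)

-- The algorithm is deferred acceptance with A proposing. A proposal to an unoccupied b needs no
-- query; a proposal to an occupied b costs one query, and its loser l is rejected by b. Since no
-- agent is ever rejected by a stable partner, the output is the A-optimal stable matching, and
-- each query's loser l ends up matched worse than the querying b. Each rejection of l by b
-- happens at most once. Conversely, a certificate Q for any stable matching M must contain a query
-- at b that l loses whenever l prefers b to M(l): otherwise moving l to the top of b's list keeps
-- every answer in Q and makes (l, b) block M. As l fares no better in M than in the A-optimal
-- matching, the pairs (b, l) inject the algorithm's queries into Q.
module Submission where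

open import Defs
open import Data.Nat using (ℕ; zero; suc; _+_; _*_; _∸_; _≤_; _<_; z≤n; s≤s; s≤s⁻¹)
open import Data.Nat.Properties
  using ( _≟_; _<?_; +-0-monoid; module ≤-Reasoning
        ; +-comm; +-assoc; +-suc; +-identityʳ; *-identityˡ; +-cancelʳ-≡; +-∸-assoc
        ; ≤-refl; ≤-reflexive; ≤-trans; <-irrefl; <-asym; <-trans; <-≤-trans
        ; ≮⇒≥; ≰⇒>; ≤∧≢⇒<; <⇒≱; m≤n⇒m<n∨m≡n; n≤1+n; 1+n≰n )
open import Data.Fin as Fin using (Fin; zero; suc; toℕ; punchOut)
open import Data.Fin.Properties
  using ( any?; all?; ¬∀⟶∃¬; toℕ<n; toℕ-fromℕ<; toℕ-injective; suc-injective; injective⇒≤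
        ; punchOut-injective; punchOut-mono-≤; punchOut-cancel-≤ )
open import Data.Vec.Functional using (Vector; updateAt)
open import Data.Vec.Functional.Properties using (updateAt-updates; updateAt-minimal)
open import Data.Maybe using (Maybe; just; nothing; fromMaybe)
open import Data.Maybe.Properties as Maybe using (just-injective)
open import Data.List using (List; []; _∷_; length; lookup; map)
open import Data.List.Relation.Unary.All as All using (All; []; _∷_)
open import Data.List.Relation.Unary.All.Properties using (¬Any⇒All¬) renaming (map⁺ to All-map⁺)
open import Data.List.Relation.Unary.Any using (index)
open import Data.List.Relation.Unary.Any.Properties using () renaming (map⁺ to Any-map⁺)
open import Data.List.Properties using (length-map)
open import Data.List.Membership.Propositional using (_∈_)
open import Data.List.Relation.Unary.AllPairs using ([]; _∷_)
open import Data.List.Relation.Unary.Unique.Propositional using (Unique)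
open import Data.List.Relation.Binary.Subset.Propositional using (_⊆_)
open import Data.List.Membership.Propositional.Properties using (∈-lookup)
open import Data.List.Membership.Setoid.Properties using (index-injective)
open import Data.Product using (Σ; _×_; _,_; proj₁; proj₂; ∃)
import Data.Product.Properties as Product
open import Data.Sum using (_⊎_; inj₁; inj₂)
open import Data.Bool using (if_then_else_)
open import Function using (_∘_; id; const; mk⇔)
open import Function.Definitions using (Injective)
open import Relation.Nullary using (¬_; Dec; yes; no; does; contradiction)
open import Relation.Nullary.Decidable using (dec-true; dec-false; does-⇔)
open import Relation.Binary.PropositionalEquality
  using (_≡_; _≢_; refl; sym; trans; cong; cong₂; subst; subst₂; setoid; module ≡-Reasoning)
open import Algebra.Properties.Monoid.Sum +-0-monoid using (sum)

injective⇒surjective : ∀ {m} {f : Fin m → Fin m} → Injective _≡_ _≡_ f →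
                       ∀ y → ∃ λ x → f x ≡ y
injective⇒surjective {suc m} {f} f-inj y with any? (λ x → f x Fin.≟ y)
... | yes hit = hit
... | no miss = contradiction (injective⇒≤ {f = squeeze} squeeze-injective) (<-irrefl refl)
  where
  squeeze : Fin (suc m) → Fin m
  squeeze x = punchOut {i = y} (λ y≡fx → miss (x , sym y≡fx))

  squeeze-injective : Injective _≡_ _≡_ squeeze
  squeeze-injective {x} {x′} eq =
    f-inj (punchOut-injective {i = y} (λ y≡fx → miss (x , sym y≡fx)) (λ y≡fx′ → miss (x′ , sym y≡fx′))
                              eq)

sum-updateAt : ∀ {A : Set} {m} (g : A → ℕ) (xs : Vector A m) i (f : A → A) →
               sum (g ∘ updateAt xs i f) + g (xs i) ≡ sum (g ∘ xs) + g (f (xs i))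
sum-updateAt {m = suc m} g xs zero f = begin
  y′ + S + y    ≡⟨ +-comm (y′ + S) y ⟩
  y + (y′ + S)  ≡⟨ cong (y +_) (+-comm y′ S) ⟩
  y + (S + y′)  ≡⟨ +-assoc y S y′ ⟨
  y + S + y′    ∎
  where
  open ≡-Reasoning
  y = g (xs zero)
  y′ = g (f (xs zero))
  S = sum (g ∘ xs ∘ suc)
sum-updateAt {m = suc m} g xs (suc i) f = begin
  y₀ + S′ + g (xs (suc i))               ≡⟨ +-assoc y₀ S′ _ ⟩
  y₀ + (S′ + g (xs (suc i)))             ≡⟨ cong (y₀ +_) (sum-updateAt g (xs ∘ suc) i f) ⟩
  y₀ + (sum (g ∘ xs ∘ suc) + g (f (xs (suc i)))) ≡⟨ +-assoc y₀ _ _ ⟨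
  sum (g ∘ xs) + g (f (xs (suc i)))       ∎
  where
  open ≡-Reasoning
  y₀ = g (xs zero)
  S′ = sum (g ∘ updateAt (xs ∘ suc) i f)

module _ {A : Set} where

  unique-lookup-injective : ∀ {xs : List A} → Unique xs →
                            ∀ {i j} → lookup xs i ≡ lookup xs j → i ≡ j
  unique-lookup-injective (_ ∷ _) {zero} {zero} _ = refl
  unique-lookup-injective (x≢ ∷ _) {zero} {suc j} eq = contradiction eq       (All.lookup x≢ (∈-lookup j))
  unique-lookup-injective (x≢ ∷ _) {suc i} {zero} eq = contradiction (sym eq) (All.lookup x≢ (∈-lookup i))
  unique-lookup-injective (_ ∷ u) {suc i} {suc j} eq = cong suc (unique-lookup-injective u eq)

  unique-⊆⇒length≤ : ∀ {xs ys : List A} → Unique xs → xs ⊆ ys → length xs ≤ length ys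
  unique-⊆⇒length≤ {xs} {ys} u xs⊆ys = injective⇒≤ {f = position} position-injective
    where
    position : Fin (length xs) → Fin (length ys)
    position i = index (xs⊆ys (∈-lookup i))

    position-injective : Injective _≡_ _≡_ position
    position-injective {i} {j} eq = unique-lookup-injective u
      (index-injective (setoid A) (xs⊆ys (∈-lookup i)) (xs⊆ys (∈-lookup j)) eq)

module _ {m : ℕ} (p : Pref m) where

  -- answer P (prefer b x y) is definitionally winner (P b) x y.
  winner : Fin m → Fin m → Fin m
  winner x y = if does (rank p x Fin.≤? rank p y) then x else y

  winner-cases : ∀ x y → (winner x y ≡ x × rank p x Fin.≤ rank p y)
                       ⊎ (winner x y ≡ y × Prefers p y x)
  winner-cases x y with rank p x Fin.≤? rank p y
  ... | yes x≤y = inj₁ (cong (λ t → if t then x else y) (dec-true  (rank p x Fin.≤? rank p y) x≤y) , x≤y)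
  ... | no x≰y  = inj₂ (cong (λ t → if t then x else y) (dec-false (rank p x Fin.≤? rank p y) x≰y)
                       , ≰⇒> x≰y)

  rank-≢ : ∀ {x y} → x ≢ y → rank p x ≢ rank p y
  rank-≢ x≢y eq = x≢y (rank-inj p eq)

winner-cong : ∀ {m} (p q : Pref m) x y →
              (rank p x Fin.≤ rank p y → rank q x Fin.≤ rank q y) →
              (rank q x Fin.≤ rank q y → rank p x Fin.≤ rank p y) →
              winner p x y ≡ winner q x y
winner-cong p q x y to from =
  cong (λ t → if t then x else y)
       (does-⇔ (mk⇔ to from) (rank p x Fin.≤? rank p y) (rank q x Fin.≤? rank q y))

other : ∀ {m} → Fin m → Fin m → Fin m → Fin m
other x y w = if does (w Fin.≟ x) then y else x

other-left : ∀ {m} (x y : Fin m) → other x y x ≡ y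
other-left x y = cong (λ t → if t then y else x) (dec-true (x Fin.≟ x) refl)

other-right : ∀ {m} (x y : Fin m) → y ≢ x → other x y y ≡ x
other-right x y y≢x = cong (λ t → if t then y else x) (dec-false (y Fin.≟ x) y≢x)

module _ {m : ℕ} (p : Pref m) {x y : Fin m} (x≢y : x ≢ y) where

  winner-other : (winner p x y ≡ x × other x y (winner p x y) ≡ y)
               ⊎ (winner p x y ≡ y × other x y (winner p x y) ≡ x)
  winner-other with winner-cases p x y
  ... | inj₁ (w≡x , _) = inj₁ (w≡x , trans (cong (other x y) w≡x) (other-left x y))
  ... | inj₂ (w≡y , _) = inj₂ (w≡y , trans (cong (other x y) w≡y) (other-right x y (x≢y ∘ sym)))

  winner-beats-other : Prefers p (winner p x y) (other x y (winner p x y))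
  winner-beats-other with winner-cases p x y
  ... | inj₁ (w≡x , x≤y) = subst (λ w → Prefers p w (other x y w)) (sym w≡x)
        (subst (Prefers p x) (sym (other-left x y)) (≤∧≢⇒< x≤y (rank-≢ p x≢y ∘ toℕ-injective)))
  ... | inj₂ (w≡y , y<x) = subst (λ w → Prefers p w (other x y w)) (sym w≡y)
        (subst (Prefers p y) (sym (other-right x y (x≢y ∘ sym))) y<x)

module _ {m : ℕ} (p : Pref (suc m)) (l : Fin (suc m)) where

  private
    l≢ : ∀ {x} → x ≢ l → rank p l ≢ rank p x
    l≢ x≢l = rank-≢ p (x≢l ∘ sym)

  promotedRank : Fin (suc m) → Fin (suc m)
  promotedRank x with x Fin.≟ l
  ... | yes _  = zero
  ... | no x≢l = suc (punchOut (l≢ x≢l))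

  promotedRank-injective : Injective _≡_ _≡_ promotedRank
  promotedRank-injective {x} {y} eq with x Fin.≟ l | y Fin.≟ l
  ... | yes x≡l | yes y≡l = trans x≡l (sym y≡l)
  ... | no x≢l  | no y≢l  = rank-inj p (punchOut-injective (l≢ x≢l) (l≢ y≢l) (suc-injective eq))

  promotedRank-top : ∀ {x} → x ≢ l → toℕ (promotedRank l) < toℕ (promotedRank x)
  promotedRank-top {x} x≢l with l Fin.≟ l | x Fin.≟ l
  ... | no l≢l | _       = contradiction refl l≢l
  ... | yes _  | yes x≡l = contradiction x≡l x≢l
  ... | yes _  | no _    = s≤s z≤n

  promotedRank-preserves-≤ : ∀ {x y} → y ≢ l → rank p x Fin.≤ rank p y →
                             promotedRank x Fin.≤ promotedRank y
  promotedRank-preserves-≤ {x} {y} y≢l x≤y with x Fin.≟ l | y Fin.≟ l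
  ... | _     | yes y≡l = contradiction y≡l y≢l
  ... | yes _ | no _    = z≤n
  ... | no x≢l | no y≢l′ = s≤s (punchOut-mono-≤ (l≢ x≢l) (l≢ y≢l′) x≤y)

  promotedRank-reflects-≤ : ∀ {x y} → x ≢ l → promotedRank x Fin.≤ promotedRank y →
                            rank p x Fin.≤ rank p y
  promotedRank-reflects-≤ {x} {y} x≢l x≤y with x Fin.≟ l | y Fin.≟ l
  ... | yes x≡l | _     = contradiction x≡l x≢l
  ... | no _    | yes _ = contradiction x≤y λ ()
  ... | no x≢l′ | no y≢l = punchOut-cancel-≤ (l≢ x≢l′) (l≢ y≢l) (s≤s⁻¹ x≤y)

promote : ∀ {m} → Pref m → Fin m → Pref m
promote {suc m} p l = record { rank = promotedRank p l ; rank-inj = promotedRank-injective p l }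

promote-top : ∀ {m} (p : Pref m) l {x} → x ≢ l → Prefers (promote p l) l x
promote-top {suc m} p l = promotedRank-top p l

promote-winner : ∀ {m} (p : Pref m) l x y → other x y (winner p x y) ≢ l →
                 winner (promote p l) x y ≡ winner p x y
promote-winner {suc m} p l x y loser≢l with winner-cases p x y
... | inj₁ (w≡x , x≤y) = sym (winner-cong p (promote p l) x y
        (promotedRank-preserves-≤ p l y≢l) (λ _ → x≤y))
  where
  y≢l : y ≢ l
  y≢l y≡l = loser≢l (trans (cong (other x y) w≡x) (trans (other-left x y) y≡l))
... | inj₂ (w≡y , y<x) = sym (winner-cong p (promote p l) x y
        (λ x≤y → contradiction x≤y (<⇒≱ y<x)) (promotedRank-reflects-≤ p l x≢l))
  where
  x≢l : x ≢ l
  x≢l x≡l = loser≢l (trans (cong (other x y) w≡y)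
    (trans (other-right x y (λ y≡x → <-irrefl (cong (toℕ ∘ rank p) y≡x) y<x)) x≡l))

loser : ∀ {n} → ProfileB n → Query n → Fin n
loser P q@(prefer _ x y) = other x y (answer P q)

key : ∀ {n} → ProfileB n → Query n → Fin n × Fin n
key P q = Query.qb q , loser P q

agree-refl : ∀ {n} (P : ProfileB n) Q → Agree P P Q
agree-refl P Q = All.tabulate (λ _ → refl)

module _ {n} (PA : ProfileA n) (PB : ProfileB n) (l b : Fin n) where

  open import Data.List.Membership.DecPropositional
    (Product.≡-dec {B = λ _ → Fin n} (Fin._≟_ {n}) (Fin._≟_ {n})) using (_∈?_)

  private
    PB′ : ProfileB n
    PB′ = updateAt PB b (λ pb → promote pb l)

    promoted-agrees : ∀ q → key PB q ≢ (b , l) → answer PB′ q ≡ answer PB q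
    promoted-agrees (prefer c x y) key≢ with c Fin.≟ b
    ... | yes refl = trans (cong (λ pc → winner pc x y) (updateAt-updates b PB))
                           (promote-winner (PB b) l x y (key≢ ∘ cong (b ,_)))
    ... | no c≢b   = cong (λ pc → winner pc x y) (updateAt-minimal c b PB c≢b)

  rejection-queried : ∀ Q M → Proves PA PB Q M → Prefers (PA l) b (toB M l) → (b , l) ∈ map (key PB) Q
  rejection-queried Q M proves b-beats-Ml with (b , l) ∈? map (key PB) Q
  ... | yes queried = queried
  ... | no unqueried = contradiction (b≢Ml , b-beats-Ml , l-beats-Mb) (proves PB′ agree l b)
    where
    agree : Agree PB PB′ Q
    agree = All.map (λ {q} b,l≢key → promoted-agrees q (b,l≢key ∘ sym))
                    (¬Any⇒All¬ Q (unqueried ∘ Any-map⁺))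

    b≢Ml : b ≢ toB M l
    b≢Ml b≡Ml = <-irrefl (cong (toℕ ∘ rank (PA l)) b≡Ml) b-beats-Ml

    Mb≢l : toA M b ≢ l
    Mb≢l Mb≡l = b≢Ml (trans (sym (toB-toA M b)) (cong (toB M) Mb≡l))

    l-beats-Mb : Prefers (PB′ b) l (toA M b)
    l-beats-Mb = subst (λ pb → Prefers pb l (toA M b)) (sym (updateAt-updates b PB))
                       (promote-top (PB b) l Mb≢l)

module DeferredAcceptance (n : ℕ) (PA : ProfileA n) where

  rankA : Fin n → Fin n → ℕ
  rankA a b = toℕ (rank (PA a) b)

  -- Junk value a when j ≥ n.
  choice : Fin n → ℕ → Fin n
  choice a j with any? (λ b → rankA a b ≟ j)
  ... | yes (b , _) = b
  ... | no _        = a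

  rankA-choice : ∀ a {j} → j < n → rankA a (choice a j) ≡ j
  rankA-choice a {j} j<n with any? (λ b → rankA a b ≟ j)
  ... | yes (_ , rank≡j) = rank≡j
  ... | no none with injective⇒surjective (rank-inj (PA a)) (Fin.fromℕ< j<n)
  ...   | b , rank≡j = contradiction (b , trans (cong toℕ rank≡j) (toℕ-fromℕ< j<n)) none

  choice-rankA : ∀ a b → choice a (rankA a b) ≡ b
  choice-rankA a b = rank-inj (PA a) (toℕ-injective (rankA-choice a (toℕ<n (rank (PA a) b))))

  -- a has been rejected rejections a times, so it currently proposes to its (rejections a)-th choice.
  record State : Set where
    constructor state
    field
      rejections : Fin n → ℕ
      holder     : Fin n → Maybe (Fin n)

  open State public

  initial : State
  initial = state (const 0) (const nothing)

  target : State → Fin n → Fin n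
  target s a = choice a (rejections s a)

  Held : State → Fin n → Set
  Held s a = ∃ λ b → holder s b ≡ just a

  held? : ∀ s a → Dec (Held s a)
  held? s a = any? (λ b → Maybe.≡-dec Fin._≟_ (holder s b) (just a))

  data Step (s : State) : Set where
    finished : (∀ a → Held s a) → Step s
    accept   : ∀ p → ¬ Held s p → holder s (target s p) ≡ nothing → Step s
    contest  : ∀ p a′ → ¬ Held s p → holder s (target s p) ≡ just a′ → Step s

  step : ∀ s → Step s
  step s with all? (held? s)
  ... | yes all-held = finished all-held
  ... | no some-free with ¬∀⟶∃¬ n (Held s) (held? s) some-free
  ...   | p , p-free with holder s (target s p) in target-holder
  ...     | nothing = accept p p-free target-holder
  ...     | just a′ = contest p a′ p-free target-holder

  accepted : State → Fin n → State
  accepted s p = state (rejections s) (updateAt (holder s) (target s p) (const (just p)))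

  -- b = target s p compares p with its holder a′ and keeps the winner w.
  contested : State → (p a′ w : Fin n) → State
  contested s p a′ w = state (updateAt (rejections s) (other p a′ w) suc)
                             (updateAt (holder s) (target s p) (const (just w)))

  partner : State → Fin n → Fin n
  partner s b = fromMaybe b (holder s b)

  identityMatching : Matching n
  identityMatching = record { toB = id ; toA = id ; toA-toB = λ _ → refl ; toB-toA = λ _ → refl }

  -- The identity fallback is junk: from a finished state satisfying the invariant, target s and
  -- partner s are mutually inverse (Finished).
  partner-target? : ∀ s → Dec (∀ a → partner s (target s a) ≡ a)
  partner-target? s = all? (λ a → partner s (target s a) Fin.≟ a)

  target-partner? : ∀ s → Dec (∀ b → target s (partner s b) ≡ b)
  target-partner? s = all? (λ b → target s (partner s b) Fin.≟ b)

  toMatching : State → Matching n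
  toMatching s with partner-target? s | target-partner? s
  ... | yes left | yes right = record { toB = target s ; toA = partner s ; toA-toB = left ; toB-toA = right }
  ... | _        | _         = identityMatching

  toMatching-spec : ∀ s → (∀ a → partner s (target s a) ≡ a) → (∀ b → target s (partner s b) ≡ b) →
                    (∀ a → toB (toMatching s) a ≡ target s a) × (∀ b → toA (toMatching s) b ≡ partner s b)
  toMatching-spec s left right with partner-target? s | target-partner? s
  ... | yes _    | yes _     = (λ _ → refl) , (λ _ → refl)
  ... | no ¬left | _         = contradiction left ¬left
  ... | yes _    | no ¬right = contradiction right ¬right

  run-from : ℕ → State → Alg n
  run-from zero    s = output identityMatching
  run-from (suc f) s with step s
  ... | finished _        = output (toMatching s)
  ... | accept p _ _      = run-from f (accepted s p)
  ... | contest p a′ _ _ = ask (prefer (target s p) p a′) (run-from f ∘ contested s p a′)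

  vacancy : Maybe (Fin n) → ℕ
  vacancy nothing  = 1
  vacancy (just _) = 0

  potential : State → ℕ
  potential s = sum ((n ∸_) ∘ rejections s) + sum (vacancy ∘ holder s)

  -- Every step lowers the potential, so the fuel is never exhausted.
  algorithm : Alg n
  algorithm = run-from (suc (potential initial)) initial

  potential-accepted : ∀ s p → holder s (target s p) ≡ nothing →
                       potential (accepted s p) < potential s
  potential-accepted s p vacant = ≤-reflexive (begin
    suc (R + H′)   ≡⟨ +-suc R H′ ⟨
    R + suc H′     ≡⟨ cong (R +_) (+-comm 1 H′) ⟩
    R + (H′ + 1)   ≡⟨ cong (λ v → R + (H′ + vacancy v)) vacant ⟨
    R + (H′ + vacancy (holder s (target s p)))
                   ≡⟨ cong (R +_) (sum-updateAt vacancy (holder s) (target s p) _) ⟩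
    R + (H + 0)    ≡⟨ cong (R +_) (+-identityʳ H) ⟩
    R + H          ∎)
    where
    open ≡-Reasoning
    R = sum ((n ∸_) ∘ rejections s)
    H = sum (vacancy ∘ holder s)
    H′ = sum (vacancy ∘ holder (accepted s p))

  potential-contested : ∀ s p a′ w → rejections s (other p a′ w) < n →
                        holder s (target s p) ≡ just a′ → potential (contested s p a′ w) < potential s
  potential-contested s p a′ w l-bounded occupied =
    ≤-reflexive (cong₂ _+_ fewer-rejections-left same-vacancies)
    where
    l = other p a′ w
    R = sum ((n ∸_) ∘ rejections s)
    R′ = sum ((n ∸_) ∘ rejections (contested s p a′ w))
    H = sum (vacancy ∘ holder s)
    H′ = sum (vacancy ∘ holder (contested s p a′ w))
    left = n ∸ suc (rejections s l)

    fewer-rejections-left : suc R′ ≡ R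
    fewer-rejections-left = +-cancelʳ-≡ left (suc R′) R (begin
      suc R′ + left          ≡⟨ +-suc R′ left ⟨
      R′ + suc left          ≡⟨ cong (R′ +_) (+-∸-assoc 1 l-bounded) ⟨
      R′ + (n ∸ rejections s l) ≡⟨ sum-updateAt (n ∸_) (rejections s) l suc ⟩
      R + left               ∎)
      where open ≡-Reasoning

    same-vacancies : H′ ≡ H
    same-vacancies = +-cancelʳ-≡ 0 H′ H (begin
      H′ + 0                       ≡⟨ cong (λ v → H′ + vacancy v) occupied ⟨
      H′ + vacancy (holder s (target s p)) ≡⟨ sum-updateAt vacancy (holder s) (target s p) _ ⟩
      H + 0                        ∎)
      where open ≡-Reasoning

  record Invariant (P : ProfileB n) (s : State) : Set where
    field
      holder-target      : ∀ {a b} → holder s b ≡ just a → target s a ≡ b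
      rejected-by-better : ∀ {a b} → rankA a b < rejections s a →
                           ∃ λ a′ → holder s b ≡ just a′ × Prefers (P b) a′ a

    -- Otherwise a was rejected by every b, so the holders form an injective map Fin n → Fin n
    -- of agents preferred to a; by surjectivity a itself is among them.
    rejections<n : ∀ a → rejections s a < n
    rejections<n a with rejections s a <? n
    ... | yes r<n = r<n
    ... | no r≮n = let (c , better-c≡a) = injective⇒surjective better-injective a in
      contradiction (subst (λ x → Prefers (P c) x a) better-c≡a (proj₂ (proj₂ (rejected c)))) (<-irrefl refl)
      where
      rejected : ∀ b → ∃ λ a′ → holder s b ≡ just a′ × Prefers (P b) a′ a
      rejected b = rejected-by-better (<-≤-trans (toℕ<n (rank (PA a) b)) (≮⇒≥ r≮n))

      better : Fin n → Fin n
      better b = proj₁ (rejected b)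

      better-injective : Injective _≡_ _≡_ better
      better-injective {b} {b′} eq = begin
        b                 ≡⟨ holder-target (proj₁ (proj₂ (rejected b))) ⟨
        target s (better b)  ≡⟨ cong (target s) eq ⟩
        target s (better b′) ≡⟨ holder-target (proj₁ (proj₂ (rejected b′))) ⟩
        b′                ∎
        where open ≡-Reasoning


    rankA-target : ∀ a → rankA a (target s a) ≡ rejections s a
    rankA-target a = rankA-choice a (rejections<n a)

  open Invariant

  invariant-initial : ∀ P → Invariant P initial
  invariant-initial P = record { holder-target = λ () ; rejected-by-better = λ () }

  invariant-accepted : ∀ {P} s p → ¬ Held s p → holder s (target s p) ≡ nothing →
                       Invariant P s → Invariant P (accepted s p)
  invariant-accepted {P} s p p-free vacant I = record
    { holder-target = holder-target′ ; rejected-by-better = rejected-by-better′ }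
    where
    b = target s p
    holder′ = holder (accepted s p)

    holder-target′ : ∀ {a c} → holder′ c ≡ just a → target s a ≡ c
    holder-target′ {a} {c} holds with c Fin.≟ b
    ... | yes refl = cong (target s) (just-injective (trans (sym holds) (updateAt-updates b (holder s))))
    ... | no c≢b   = holder-target I (trans (sym (updateAt-minimal c b (holder s) c≢b)) holds)

    rejected-by-better′ : ∀ {a c} → rankA a c < rejections s a →
                          ∃ λ a′ → holder′ c ≡ just a′ × Prefers (P c) a′ a
    rejected-by-better′ {a} {c} rejected with rejected-by-better I rejected
    ... | a′ , holds , prefers with c Fin.≟ b
    ...   | yes refl = contradiction (trans (sym vacant) holds) λ ()
    ...   | no c≢b   = a′ , trans (updateAt-minimal c b (holder s) c≢b) holds , prefers

  NoStablePartnerRejected : ProfileB n → State → Set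
  NoStablePartnerRejected P s = ∀ M → Stable PA P M → ∀ a → rejections s a ≤ rankA a (toB M a)

  module Contest {P : ProfileB n} (s : State) (p a′ : Fin n) (p-free : ¬ Held s p)
                 (occupied : holder s (target s p) ≡ just a′) (I : Invariant P s)
                 (w : Fin n) (w-wins : winner (P (target s p)) p a′ ≡ w) where

    b = target s p
    l = other p a′ w
    s′ = contested s p a′ w

    p≢a′ : p ≢ a′
    p≢a′ refl = p-free (b , occupied)

    winner-loser : (w ≡ p × l ≡ a′) ⊎ (w ≡ a′ × l ≡ p)
    winner-loser = subst (λ v → (v ≡ p × other p a′ v ≡ a′) ⊎ (v ≡ a′ × other p a′ v ≡ p))
                         w-wins (winner-other (P b) p≢a′)

    w-beats-l : Prefers (P b) w l
    w-beats-l = subst (λ v → Prefers (P b) v (other p a′ v)) w-wins (winner-beats-other (P b) p≢a′)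

    l-contestant : l ≡ p ⊎ l ≡ a′
    l-contestant with winner-loser
    ... | inj₁ (_ , l≡a′) = inj₂ l≡a′
    ... | inj₂ (_ , l≡p)  = inj₁ l≡p

    contestant-target : ∀ {x} → x ≡ p ⊎ x ≡ a′ → target s x ≡ b
    contestant-target (inj₁ refl) = refl
    contestant-target (inj₂ refl) = holder-target I occupied

    w-target : target s w ≡ b
    w-target with winner-loser
    ... | inj₁ (w≡p , _)  = contestant-target (inj₁ w≡p)
    ... | inj₂ (w≡a′ , _) = contestant-target (inj₂ w≡a′)

    l-target : target s l ≡ b
    l-target = contestant-target l-contestant

    w≢l : w ≢ l
    w≢l w≡l with winner-loser
    ... | inj₁ (w≡p , l≡a′) = p≢a′ (trans (sym w≡p) (trans w≡l l≡a′))
    ... | inj₂ (w≡a′ , l≡p) = p≢a′ (trans (sym l≡p) (trans (sym w≡l) w≡a′))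

    rankA-l-b : rankA l b ≡ rejections s l
    rankA-l-b = trans (cong (rankA l) (sym l-target)) (rankA-target I l)

    rejections-l : rejections s′ l ≡ suc (rejections s l)
    rejections-l = updateAt-updates l (rejections s)

    rejections-other : ∀ {a} → a ≢ l → rejections s′ a ≡ rejections s a
    rejections-other a≢l = updateAt-minimal _ l (rejections s) a≢l

    target-other : ∀ {a} → a ≢ l → target s′ a ≡ target s a
    target-other a≢l = cong (choice _) (rejections-other a≢l)

    rejections-≤ : ∀ a → rejections s a ≤ rejections s′ a
    rejections-≤ a with a Fin.≟ l
    ... | yes refl = subst (rejections s l ≤_) (sym rejections-l) (n≤1+n _)
    ... | no a≢l   = ≤-reflexive (sym (rejections-other a≢l))

    l-moved-past-b : ¬ (rejections s′ l ≤ rankA l b)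
    l-moved-past-b passed = 1+n≰n (subst₂ _≤_ rejections-l rankA-l-b passed)

    holder-b : holder s′ b ≡ just w
    holder-b = updateAt-updates b (holder s)

    holder-other : ∀ {c} → c ≢ b → holder s′ c ≡ holder s c
    holder-other c≢b = updateAt-minimal _ b (holder s) c≢b

    holder-target′ : ∀ {a c} → holder s′ c ≡ just a → target s′ a ≡ c
    holder-target′ {a} {c} holds with c Fin.≟ b
    ... | yes refl = begin
      target s′ a ≡⟨ cong (target s′) (just-injective (trans (sym holds) holder-b)) ⟩
      target s′ w ≡⟨ target-other w≢l ⟩
      target s w  ≡⟨ w-target ⟩
      b           ∎
      where open ≡-Reasoning
    ... | no c≢b = trans (target-other a≢l) (holder-target I holds-before)
      where
      holds-before : holder s c ≡ just a
      holds-before = trans (sym (holder-other c≢b)) holds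

      a≢l : a ≢ l
      a≢l a≡l with l-contestant
      ... | inj₁ l≡p  = p-free (c , trans holds-before (cong just (trans a≡l l≡p)))
      ... | inj₂ l≡a′ = c≢b (begin
        c           ≡⟨ holder-target I holds-before ⟨
        target s a  ≡⟨ cong (target s) (trans a≡l l≡a′) ⟩
        target s a′ ≡⟨ holder-target I occupied ⟩
        b           ∎)
        where open ≡-Reasoning

    rejected-at-b : ∀ {a} → rankA a b < rejections s′ a → Prefers (P b) w a
    rejected-at-b {a} rejected with a Fin.≟ l
    ... | yes refl = w-beats-l
    ... | no a≢l with rejected-by-better I (subst (rankA a b <_) (rejections-other a≢l) rejected)
    ...   | a″ , holds , a″-beats-a with just-injective (trans (sym holds) occupied) | winner-loser
    ...     | refl | inj₁ (_ , l≡a′)   = <-trans (subst (Prefers (P b) w) l≡a′ w-beats-l) a″-beats-a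
    ...     | refl | inj₂ (refl , _)    = a″-beats-a

    rejected-before : ∀ {a c} → c ≢ b → rankA a c < rejections s′ a → rankA a c < rejections s a
    rejected-before {a} {c} c≢b rejected with a Fin.≟ l
    ... | no a≢l   = subst (rankA a c <_) (rejections-other a≢l) rejected
    ... | yes refl = ≤∧≢⇒< (s≤s⁻¹ (subst (rankA l c <_) rejections-l rejected)) c-not-target
      where
      c-not-target : rankA l c ≢ rejections s l
      c-not-target eq = c≢b (trans (sym (choice-rankA l c)) (trans (cong (choice l) eq) l-target))

    rejected-by-better′ : ∀ {a c} → rankA a c < rejections s′ a →
                          ∃ λ a′ → holder s′ c ≡ just a′ × Prefers (P c) a′ a
    rejected-by-better′ {a} {c} rejected with c Fin.≟ b
    ... | yes refl = w , holder-b , rejected-at-b rejected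
    ... | no c≢b with rejected-by-better I (rejected-before c≢b rejected)
    ...   | a″ , holds , a″-beats-a = a″ , trans (holder-other c≢b) holds , a″-beats-a

    invariant′ : Invariant P s′
    invariant′ = record { holder-target = holder-target′ ; rejected-by-better = rejected-by-better′ }

    potential-decreases : potential s′ < potential s
    potential-decreases = potential-contested s p a′ w (rejections<n I l) occupied

    -- If l's stable partner were b, then w and b would block.
    no-stable-partner-rejected′ : NoStablePartnerRejected P s → NoStablePartnerRejected P s′
    no-stable-partner-rejected′ unrejected M M-stable a with a Fin.≟ l
    ... | no a≢l   = subst (_≤ rankA a (toB M a)) (sym (rejections-other a≢l)) (unrejected M M-stable a)
    ... | yes refl with m≤n⇒m<n∨m≡n (unrejected M M-stable l)
    ...   | inj₁ below = subst (_≤ rankA l (toB M l)) (sym rejections-l) below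
    ...   | inj₂ at    = contradiction (b≢Mw , b-beats-Mw , w-beats-Mb) (M-stable w b)
      where
      Ml≡b : toB M l ≡ b
      Ml≡b = trans (sym (choice-rankA l (toB M l))) (trans (cong (choice l) (sym at)) l-target)

      Mb≡l : toA M b ≡ l
      Mb≡l = trans (cong (toA M) (sym Ml≡b)) (toA-toB M l)

      b≢Mw : b ≢ toB M w
      b≢Mw b≡Mw = w≢l (trans (sym (toA-toB M w)) (trans (cong (toA M) (sym b≡Mw)) Mb≡l))

      rankA-w-b : rankA w b ≡ rejections s w
      rankA-w-b = trans (cong (rankA w) (sym w-target)) (rankA-target I w)

      b-beats-Mw : Prefers (PA w) b (toB M w)
      b-beats-Mw = ≤∧≢⇒< (subst (_≤ rankA w (toB M w)) (sym rankA-w-b) (unrejected M M-stable w))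
                         (b≢Mw ∘ rank-inj (PA w) ∘ toℕ-injective)

      w-beats-Mb : Prefers (P b) w (toA M b)
      w-beats-Mb = subst (Prefers (P b) w) (sym Mb≡l) w-beats-l

  module Finished {P : ProfileB n} (s : State) (all-held : ∀ a → Held s a) (I : Invariant P s) where

    holds-target : ∀ a → holder s (target s a) ≡ just a
    holds-target a = subst (λ b → holder s b ≡ just a) (sym (holder-target I held)) held
      where held = proj₂ (all-held a)

    partner-target : ∀ a → partner s (target s a) ≡ a
    partner-target a = cong (fromMaybe (target s a)) (holds-target a)

    target-injective : Injective _≡_ _≡_ (target s)
    target-injective {a} {a′} eq =
      just-injective (trans (sym (holds-target a)) (trans (cong (holder s) eq) (holds-target a′)))

    target-partner : ∀ b → target s (partner s b) ≡ b
    target-partner b with injective⇒surjective target-injective b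
    ... | a , refl = cong (target s) (partner-target a)

    toB-target : ∀ a → toB (toMatching s) a ≡ target s a
    toB-target = proj₁ (toMatching-spec s partner-target target-partner)

    toA-partner : ∀ b → toA (toMatching s) b ≡ partner s b
    toA-partner = proj₂ (toMatching-spec s partner-target target-partner)

    rankA-toB : ∀ a → rankA a (toB (toMatching s) a) ≡ rejections s a
    rankA-toB a = trans (cong (rankA a) (toB-target a)) (rankA-target I a)

    stable : Stable PA P (toMatching s)
    stable a c (_ , c-beats-Ma , a-beats-Mc)
      with rejected-by-better I (subst (rankA a c <_) (rankA-toB a) c-beats-Ma)
    ... | a″ , holds , a″-beats-a =
      <-asym a-beats-Mc (subst (λ x → Prefers (P c) x a) Mc≡a″ a″-beats-a)
      where
      Mc≡a″ : a″ ≡ toA (toMatching s) c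
      Mc≡a″ = sym (trans (toA-partner c) (cong (fromMaybe c) holds))

  fuel-step : ∀ {m m′ f} → m′ < m → m < suc f → m′ < f
  fuel-step decreases fuel = <-≤-trans decreases (s≤s⁻¹ fuel)

  module Run (PB : ProfileB n) where

    module Answered (s : State) (p a′ : Fin n) (p-free : ¬ Held s p)
                    (occupied : holder s (target s p) ≡ just a′) (I : Invariant PB s) =
      Contest s p a′ p-free occupied I (answer PB (prefer (target s p) p a′)) refl

    -- The first component makes the keys of the queries distinct; the second forces every key
    -- into every certificate.
    Charged : State → Matching n → Query n → Set
    Charged s M q = rejections s (loser PB q) ≤ rankA (loser PB q) (Query.qb q)
                  × rankA (loser PB q) (Query.qb q) < rankA (loser PB q) (toB M (loser PB q))

    result-stable : ∀ P f s → potential s < f → Invariant P s →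
                    Agree PB P (queries (run-from f s) PB) → Stable PA P (result (run-from f s) PB)
    result-stable P (suc f) s fuel I agree with step s
    ... | finished all-held = Finished.stable s all-held I
    ... | accept p p-free vacant =
      result-stable P f (accepted s p) (fuel-step (potential-accepted s p vacant) fuel)
        (invariant-accepted s p p-free vacant I) agree
    ... | contest p a′ p-free occupied =
      result-stable P f C.s′ (fuel-step C.potential-decreases fuel) C.invariant′ (All.tail agree)
      where module C = Contest s p a′ p-free occupied I (answer PB (prefer (target s p) p a′)) (All.head agree)

    rejections≤result : ∀ f s → potential s < f → Invariant PB s →
                        ∀ a → rejections s a ≤ rankA a (toB (result (run-from f s) PB) a)
    rejections≤result (suc f) s fuel I a with step s
    ... | finished all-held = ≤-reflexive (sym (Finished.rankA-toB s all-held I a))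
    ... | accept p p-free vacant =
      rejections≤result f (accepted s p) (fuel-step (potential-accepted s p vacant) fuel)
        (invariant-accepted s p p-free vacant I) a
    ... | contest p a′ p-free occupied = ≤-trans (C.rejections-≤ a)
      (rejections≤result f C.s′ (fuel-step C.potential-decreases fuel) C.invariant′ a)
      where module C = Answered s p a′ p-free occupied I

    result-optimal : ∀ f s → potential s < f → Invariant PB s → NoStablePartnerRejected PB s →
                     ∀ M → Stable PA PB M → ∀ a →
                     rankA a (toB (result (run-from f s) PB) a) ≤ rankA a (toB M a)
    result-optimal (suc f) s fuel I unrejected M M-stable a with step s
    ... | finished all-held =
      subst (_≤ rankA a (toB M a)) (sym (Finished.rankA-toB s all-held I a)) (unrejected M M-stable a)
    ... | accept p p-free vacant =
      result-optimal f (accepted s p) (fuel-step (potential-accepted s p vacant) fuel)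
        (invariant-accepted s p p-free vacant I) unrejected M M-stable a
    ... | contest p a′ p-free occupied =
      result-optimal f C.s′ (fuel-step C.potential-decreases fuel) C.invariant′
        (C.no-stable-partner-rejected′ unrejected) M M-stable a
      where module C = Answered s p a′ p-free occupied I

    queries-charged : ∀ f s → potential s < f → Invariant PB s →
                      All (Charged s (result (run-from f s) PB)) (queries (run-from f s) PB)
    queries-charged (suc f) s fuel I with step s
    ... | finished _ = []
    ... | accept p p-free vacant =
      queries-charged f (accepted s p) (fuel-step (potential-accepted s p vacant) fuel)
        (invariant-accepted s p p-free vacant I)
    ... | contest p a′ p-free occupied =
      (≤-reflexive (sym C.rankA-l-b) , b-beats-final)
      ∷ All.map (λ (not-passed , worse) → ≤-trans (C.rejections-≤ _) not-passed , worse) later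
      where
      module C = Answered s p a′ p-free occupied I
      fuel′ = fuel-step C.potential-decreases fuel
      final = toB (result (run-from f C.s′) PB) C.l

      b-beats-final : rankA C.l C.b < rankA C.l final
      b-beats-final = subst (_≤ rankA C.l final) (trans C.rejections-l (cong suc (sym C.rankA-l-b)))
                            (rejections≤result f C.s′ fuel′ C.invariant′ C.l)

      later = queries-charged f C.s′ fuel′ C.invariant′

    queries-unique : ∀ f s → potential s < f → Invariant PB s →
                     Unique (map (key PB) (queries (run-from f s) PB))
    queries-unique (suc f) s fuel I with step s
    ... | finished _ = []
    ... | accept p p-free vacant =
      queries-unique f (accepted s p) (fuel-step (potential-accepted s p vacant) fuel)
        (invariant-accepted s p p-free vacant I)
    ... | contest p a′ p-free occupied =
      All-map⁺ (All.map not-repeated (queries-charged f C.s′ fuel′ C.invariant′))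
      ∷ queries-unique f C.s′ fuel′ C.invariant′
      where
      module C = Answered s p a′ p-free occupied I
      fuel′ = fuel-step C.potential-decreases fuel

      not-repeated : ∀ {q} → Charged C.s′ (result (run-from f C.s′) PB) q → (C.b , C.l) ≢ key PB q
      not-repeated (not-passed , _) same-key =
        C.l-moved-past-b (subst₂ (λ a c → rejections C.s′ a ≤ rankA a c)
                                 (sym (cong proj₂ same-key)) (sym (cong proj₁ same-key)) not-passed)

  correct : Correct PA algorithm
  correct PB P = Run.result-stable PB P _ initial ≤-refl (invariant-initial P)

  optimal : ∀ PB M → Stable PA PB M → ∀ a → rankA a (toB (result algorithm PB) a) ≤ rankA a (toB M a)
  optimal PB = Run.result-optimal PB _ initial ≤-refl (invariant-initial PB) (λ _ _ _ → z≤n)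

  a-optimal : ∀ PB → AOptimal PA PB (result algorithm PB)
  a-optimal PB = correct PB PB (agree-refl PB _) , optimal PB

  queries≤certificate : ∀ PB Q M → Proves PA PB Q M → length (queries algorithm PB) ≤ length Q
  queries≤certificate PB Q M proves = begin
    length (queries algorithm PB)                ≡⟨ length-map (key PB) (queries algorithm PB) ⟨
    length (map (key PB) (queries algorithm PB)) ≤⟨ unique-⊆⇒length≤ keys-unique keys-queried ⟩
    length (map (key PB) Q)                      ≡⟨ length-map (key PB) Q ⟩
    length Q                                     ∎
    where
    open ≤-Reasoning

    keys-unique : Unique (map (key PB) (queries algorithm PB))
    keys-unique = Run.queries-unique PB _ initial ≤-refl (invariant-initial PB)

    queried : ∀ {q} → Run.Charged PB initial (result algorithm PB) q → key PB q ∈ map (key PB) Q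
    queried (_ , b-beats-final) = rejection-queried PA PB _ _ Q M proves
      (<-≤-trans b-beats-final (optimal PB M (proves PB (agree-refl PB Q)) _))

    keys-queried : map (key PB) (queries algorithm PB) ⊆ map (key PB) Q
    keys-queried = All.lookup (All-map⁺ (All.map queried
      (Run.queries-charged PB _ initial ≤-refl (invariant-initial PB))))

theorem6 : (n : ℕ) (PA : ProfileA n) →
    Σ (Alg n) (λ alg → Competitive 1 PA alg × (∀ PB → AOptimal PA PB (result alg PB)))
theorem6 n PA = algorithm , (correct , competitive) , a-optimal
  where
  open DeferredAcceptance n PA

  competitive : ∀ PB Q M → Proves PA PB Q M → length (queries algorithm PB) ≤ 1 * length Q
  competitive PB Q M proves = subst (_ ≤_) (sym (*-identityˡ (length Q))) (queries≤certificate PB Q M proves)
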